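{- For every integer $\alpha\ge1$, \[\alpha\sum_{g=1}^{\alpha+1}\left[\binom{\alpha+1}{g-1}(g-1)!\,(2\alpha+1-g)!\right]+\alpha!\,(\alpha+1)!=(2\alpha+1)!,\] with the conventions $0!=1$ and $\binom{n}{0}=1$. -}

module Defs where

open import Data.Nat using (ℕ; zero; suc; _+_)

sumFrom1 : ℕ → (ℕ → ℕ) → ℕ
sumFrom1 zero    f = 0
sumFrom1 (suc m) f = sumFrom1 m f + f (suc m)

-- With N = a + n, put R m = C(n,m) m! (N − m)!.  Since C(n,m+1) (m+1)! = C(n,m) m! (n − m)
-- and (N − m)! = (a + (n − m)) (N − m − 1)!, one step gives R m = a·s(m+1) + R(m+1), where
-- s g is the g-th summand.  The sum therefore telescopes from R 0 = N! down to R n = a! n!.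
{-# OPTIONS --safe #-}
module Submission where

open import Defs
open import Data.Nat using (ℕ; zero; suc; _+_; _*_; _∸_; _≥_; _!; _≤_)
open import Data.Nat.Combinatorics using (_C_; nCn≡1; [n-k]*[n-k-1]!≡[n-k]!; k![n∸k]!∣n!)
open import Data.Nat.Combinatorics.Specification using (nCk≡n!/k![n-k]!)
open import Data.Nat.Properties
open import Data.Nat.DivMod using (m/n*n≡m)
open import Data.Nat.Tactic.RingSolver using (solve-∀)
open import Relation.Binary.PropositionalEquality

nCk*[k!*[n∸k]!]≡n! : ∀ {n k} → k ≤ n → (n C k) * (k ! * (n ∸ k) !) ≡ n !
nCk*[k!*[n∸k]!]≡n! {n} {k} k≤n =
  trans (cong (_* (k ! * (n ∸ k) !)) (nCk≡n!/k![n-k]! k≤n))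
        (m/n*n≡m {{k !* (n ∸ k) !≢0}} (k![n∸k]!∣n! k≤n))

nC[k+1]*[k+1]!≡nCk*k!*[n∸k] : ∀ {n k} → suc k ≤ n →
  (n C suc k) * suc k ! ≡ (n C k) * k ! * (n ∸ k)
nC[k+1]*[k+1]!≡nCk*k!*[n∸k] {n} {k} k<n = *-cancelʳ-≡ _ _ R {{(n ∸ suc k) !≢0}} (begin
  (n C suc k) * suc k ! * R        ≡⟨ *-assoc (n C suc k) (suc k !) R ⟩
  (n C suc k) * (suc k ! * R)      ≡⟨ nCk*[k!*[n∸k]!]≡n! k<n ⟩
  n !                              ≡⟨ nCk*[k!*[n∸k]!]≡n! (<⇒≤ k<n) ⟨
  (n C k) * (k ! * (n ∸ k) !)      ≡⟨ cong (λ x → (n C k) * (k ! * x)) ([n-k]*[n-k-1]!≡[n-k]! k<n) ⟨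
  (n C k) * (k ! * ((n ∸ k) * R))  ≡⟨ reassociate (n C k) (k !) (n ∸ k) R ⟩
  (n C k) * k ! * (n ∸ k) * R      ∎)
  where
  open ≡-Reasoning
  R = (n ∸ suc k) !
  reassociate : ∀ w x y z → w * (x * (y * z)) ≡ w * x * y * z
  reassociate = solve-∀

summand : ℕ → ℕ → ℕ → ℕ
summand n N g = (n C (g ∸ 1)) * (g ∸ 1) ! * (N ∸ g) !

remainder : ℕ → ℕ → ℕ → ℕ
remainder n N m = (n C m) * m ! * (N ∸ m) !

module _ {a n N : ℕ} (a+n≡N : a + n ≡ N) where

  remainder-step : ∀ {m} → suc m ≤ n →
    remainder n N m ≡ a * summand n N (suc m) + remainder n N (suc m)
  remainder-step {m} m<n = begin
    F * (N ∸ m) !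
      ≡⟨ cong (F *_) ([n-k]*[n-k-1]!≡[n-k]! m<N) ⟨
    F * ((N ∸ m) * R)
      ≡⟨ cong (λ x → F * (x * R)) N∸m≡a+[n∸m] ⟩
    F * ((a + (n ∸ m)) * R)
      ≡⟨ distribute a F (n ∸ m) R ⟩
    a * (F * R) + F * (n ∸ m) * R
      ≡⟨ cong (λ x → a * (F * R) + x * R) (nC[k+1]*[k+1]!≡nCk*k!*[n∸k] m<n) ⟨
    a * (F * R) + (n C suc m) * suc m ! * R
      ∎
    where
    open ≡-Reasoning
    F = (n C m) * m !
    R = (N ∸ suc m) !
    m<N : suc m ≤ N
    m<N = ≤-trans m<n (≤-trans (m≤n+m n a) (≤-reflexive a+n≡N))
    N∸m≡a+[n∸m] : N ∸ m ≡ a + (n ∸ m)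
    N∸m≡a+[n∸m] = trans (cong (_∸ m) (sym a+n≡N)) (+-∸-assoc a (<⇒≤ m<n))
    distribute : ∀ w x y z → x * ((w + y) * z) ≡ w * (x * z) + x * y * z
    distribute = solve-∀

  partial-sum+remainder≡N! : ∀ {m} → m ≤ n →
    a * sumFrom1 m (summand n N) + remainder n N m ≡ N !
  -- remainder n N 0 computes to N ! + 0.
  partial-sum+remainder≡N! {zero} _ = trans (cong (_+ (N ! + 0)) (*-zeroʳ a)) (+-identityʳ (N !))
  partial-sum+remainder≡N! {suc m} m<n = begin
    a * (S + summand n N (suc m)) + remainder n N (suc m)
      ≡⟨ cong (_+ remainder n N (suc m)) (*-distribˡ-+ a S (summand n N (suc m))) ⟩
    a * S + a * summand n N (suc m) + remainder n N (suc m)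
      ≡⟨ +-assoc (a * S) _ _ ⟩
    a * S + (a * summand n N (suc m) + remainder n N (suc m))
      ≡⟨ cong (a * S +_) (remainder-step m<n) ⟨
    a * S + remainder n N m
      ≡⟨ partial-sum+remainder≡N! (<⇒≤ m<n) ⟩
    N ! ∎
    where
    open ≡-Reasoning
    S = sumFrom1 m (summand n N)

  remainder[n]≡a!*n! : remainder n N n ≡ a ! * n !
  remainder[n]≡a!*n! = begin
    (n C n) * n ! * (N ∸ n) !  ≡⟨ cong₂ (λ c d → c * n ! * d !) (nCn≡1 n) N∸n≡a ⟩
    1 * n ! * a !              ≡⟨ cong (_* a !) (*-identityˡ (n !)) ⟩
    n ! * a !                  ≡⟨ *-comm (n !) (a !) ⟩
    a ! * n !                  ∎
    where
    open ≡-Reasoning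
    N∸n≡a : N ∸ n ≡ a
    N∸n≡a = trans (cong (_∸ n) (sym a+n≡N)) (m+n∸n≡m a n)

  sum+a!n!≡N! : a * sumFrom1 n (summand n N) + a ! * n ! ≡ N !
  sum+a!n!≡N! = trans (cong (a * sumFrom1 n (summand n N) +_) (sym remainder[n]≡a!*n!))
                      (partial-sum+remainder≡N! ≤-refl)

-- The identity also holds for α = 0.
lemma2 : ∀ (α : ℕ) → α ≥ 1 →
    α * sumFrom1 (α + 1) (λ g → ((α + 1) C (g ∸ 1)) * ((g ∸ 1) !) * ((2 * α + 1 ∸ g) !))
      + (α !) * ((α + 1) !)
      ≡ (2 * α + 1) !
lemma2 α _ = sum+a!n!≡N! {α} {α + 1} (m+[m+1]≡2m+1 α)
  where
  m+[m+1]≡2m+1 : ∀ m → m + (m + 1) ≡ 2 * m + 1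
  m+[m+1]≡2m+1 = solve-∀
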